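{- Let $q=p^s$ with $p$ an odd prime, and let $d>1$ be an integer. If $\gcd(d,\phi(d))=1$, $2d\mid(q-1)$ and $d\mid s$, then $\omega(GP(q,d))\ge q^{1/d}$. In particular, if $d$ is a prime such that $2d\mid(q-1)$ and $d\mid s$, then $\omega(GP(q,d))\ge q^{1/d}$.
   Context: $\phi$ is Euler's totient function. For $d>1$ and $q\equiv1\pmod{2d}$, $GP(q,d)$ is the graph on $\mathbb{F}_q$ where distinct $x,y$ are adjacent iff $x-y=z^d$ for some $z\in\mathbb{F}_q$; $\omega$ denotes clique number. -}

module Defs where

open import Level using (0ℓ)
open import Data.Nat using (ℕ; zero; suc)
open import Data.Nat.GCD using (gcd)
open import Data.Nat.Properties using (_≟_)
open import Data.Fin using (Fin)
open import Data.List using (List; length; filter; applyUpTo)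
open import Data.List.Relation.Unary.AllPairs using (AllPairs)
open import Data.Product using (∃; _×_)
open import Relation.Binary.PropositionalEquality using (_≡_; _≢_)
open import Algebra.Structures using (IsCommutativeRing)

φ : ℕ → ℕ
φ d = length (filter (λ k → gcd k d ≟ 1) (applyUpTo suc d))

-- A field whose underlying set is Fin q (i.e. a field with exactly q elements).
-- Equality is propositional equality on Fin q.
record FiniteField (q : ℕ) : Set where
  infixl 6 _+_
  infixl 7 _*_
  field
    _+_ _*_ : Fin q → Fin q → Fin q
    -_ : Fin q → Fin q
    0# 1# : Fin q
    isCommutativeRing : IsCommutativeRing _≡_ _+_ _*_ -_ 0# 1#
    0≢1 : 0# ≢ 1#
    inverse : ∀ x → x ≢ 0# → ∃ λ y → x * y ≡ 1#

  _-_ : Fin q → Fin q → Fin q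
  x - y = x + (- y)

  _^_ : Fin q → ℕ → Fin q
  x ^ zero = 1#
  x ^ suc n = x * (x ^ n)

module _ {q : ℕ} (F : FiniteField q) where
  open FiniteField F

  GPAdj : ℕ → Fin q → Fin q → Set
  GPAdj d x y = x ≢ y × ∃ λ z → x - y ≡ z ^ d

  IsGPClique : ℕ → List (Fin q) → Set
  IsGPClique d xs = AllPairs (GPAdj d) xs

module Submission where

-- Write s = t·d and r = p^t, so that q = r^d. The map x ↦ x^r is additive, so its fixed
-- points, 0 and the (r-1)-th roots of unity, form a subfield K of size r, closed under
-- differences. Put k = (q-1)/(r-1) = 1 + r + … + r^(d-1). The k-th power map is at most
-- k-to-one on the q-1 units, so its image has at least r-1 elements, all roots of
-- x^(r-1) = 1; as that polynomial has at most r-1 roots, every (r-1)-th root of unity is a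
-- k-th power. Since d ∣ q-1 we have r^d ≡ 1 (mod d), and Euler's theorem with
-- gcd(d, φ(d)) = 1 turns this into r ≡ 1 (mod d); hence k ≡ d ≡ 0 (mod d), every k-th power
-- is a d-th power, and K is a clique with r = q^(1/d) vertices. For prime d, 0 < φ(d) < d.

open import Data.Nat using (ℕ; suc)
open import Defs using (FiniteField)

module PrimeBinomial where
  open import Data.Nat
  open import Data.Nat.Properties
  open import Data.Nat.Divisibility
  open import Data.Nat.DivMod
  open import Data.Nat.Primality
  open import Data.Nat.Combinatorics
  open import Data.Sum using (inj₁; inj₂)
  open import Data.Empty using (⊥-elim)
  open import Relation.Nullary using (¬_)
  open import Relation.Binary.PropositionalEquality

  n∣n! : ∀ n → 0 < n → n ∣ n !
  n∣n! (suc n) _ = m∣m*n (n !)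

  module _ {p : ℕ} (p-prime : Prime p) where

    private
      1<p : 1 < p
      1<p = nonTrivial⇒n>1 p
        where open Prime p-prime

    prime∤m! : ∀ m → m < p → ¬ p ∣ m !
    prime∤m! zero _ p∣1 = <⇒≱ 1<p (∣⇒≤ p∣1)
    prime∤m! (suc m) m<p p∣m! with euclidsLemma (suc m) (m !) p-prime p∣m!
    ... | inj₁ p∣1+m = <⇒≱ m<p (∣⇒≤ p∣1+m)
    ... | inj₂ p∣m!  = prime∤m! m (<-trans (n<1+n m) m<p) p∣m!

    prime∣pCk : ∀ {k} → 0 < k → k < p → p ∣ p C k
    prime∣pCk {k} 0<k k<p with euclidsLemma (k ! * (p ∸ k) !) (p C k) p-prime p∣k![p∸k]!*pCk
      where
      instance k![p∸k]!≢0 : NonZero (k ! * (p ∸ k) !)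
      k![p∸k]!≢0 = k !* (p ∸ k) !≢0
      k![p∸k]!*pCk≡p! : k ! * (p ∸ k) ! * (p C k) ≡ p !
      k![p∸k]!*pCk≡p! = trans (cong (k ! * (p ∸ k) ! *_) (nCk≡n!/k![n-k]! (<⇒≤ k<p)))
                              (m*[n/m]≡n (k![n∸k]!∣n! (<⇒≤ k<p)))
      p∣k![p∸k]!*pCk : p ∣ k ! * (p ∸ k) ! * (p C k)
      p∣k![p∸k]!*pCk = subst (p ∣_) (sym k![p∸k]!*pCk≡p!) (n∣n! p (<-trans z<s 1<p))
    ... | inj₂ p∣pCk = p∣pCk
    ... | inj₁ p∣k![p∸k]! with euclidsLemma (k !) ((p ∸ k) !) p-prime p∣k![p∸k]!
    ...   | inj₁ p∣k! = ⊥-elim (prime∤m! k k<p p∣k!)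
    ...   | inj₂ p∣[p∸k]! = ⊥-elim (prime∤m! (p ∸ k) (∸-monoʳ-< 0<k (<⇒≤ k<p)) p∣[p∸k]!)

module Totient where
  open import Level using (0ℓ)
  open import Function using (_∘_)
  open import Data.Nat
  open import Data.Nat.Properties
  open import Data.Nat.Divisibility
  open import Data.Nat.DivMod
  open import Data.Nat.GCD
  open import Data.Nat.Primality using (Prime; prime⇒irreducible)
  open import Data.Nat.Tactic.RingSolver using (solve-∀)
  open import Data.Fin using (Fin; toℕ; fromℕ<)
  import Data.Fin.Properties as Finₚ
  import Data.Fin.Permutation as Perm
  open import Data.List using (List; []; _∷_; _++_; applyUpTo; upTo; filter; length; _∷ʳ_)
  open import Data.Nat.ListAction using (product)
  import Data.List.Properties as Listₚ
  open import Data.Product using (∃; _,_; proj₁; proj₂)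
  open import Data.Sum using (inj₁; inj₂)
  open import Data.Empty using (⊥-elim)
  open import Relation.Nullary using (¬_; yes; no; Dec)
  open import Relation.Binary.PropositionalEquality
  open import Algebra.Bundles using (CommutativeMonoid)
  import Algebra.Properties.CommutativeMonoid.Sum as CommutativeMonoidSum
  open import Defs using (φ)

  geometricSum : ℕ → ℕ → ℕ
  geometricSum r zero = 0
  geometricSum r (suc k) = 1 + r * geometricSum r k

  [1+m]^k≡1+m*geometricSum : ∀ m k → suc m ^ k ≡ 1 + m * geometricSum (suc m) k
  [1+m]^k≡1+m*geometricSum m zero = cong suc (sym (*-zeroʳ m))
  [1+m]^k≡1+m*geometricSum m (suc k) = begin
    suc m * suc m ^ k                                  ≡⟨ cong (suc m *_) ([1+m]^k≡1+m*geometricSum m k) ⟩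
    suc m * (1 + m * geometricSum (suc m) k)           ≡⟨ expand m (geometricSum (suc m) k) ⟩
    1 + m * (1 + suc m * geometricSum (suc m) k)       ∎
    where
    open ≡-Reasoning
    expand : ∀ m g → suc m * (1 + m * g) ≡ 1 + m * (1 + suc m * g)
    expand = solve-∀

  -- The modulus is written 2 + e so that 1 % d reduces to 1.
  module Modulo (e : ℕ) where

    d : ℕ
    d = 2 + e

    infix 4 _≈_
    _≈_ : ℕ → ℕ → Set
    a ≈ b = a % d ≡ b % d

    %-≈ : ∀ a → a % d ≈ a
    %-≈ a = m%n%n≡m%n a d

    *-cong-≈ : ∀ {a a′ b b′} → a ≈ a′ → b ≈ b′ → a * b ≈ a′ * b′
    *-cong-≈ {a} {a′} {b} {b′} a≈a′ b≈b′ = begin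
      (a * b) % d                   ≡⟨ %-distribˡ-* a b d ⟩
      ((a % d) * (b % d)) % d       ≡⟨ cong₂ (λ x y → (x * y) % d) a≈a′ b≈b′ ⟩
      ((a′ % d) * (b′ % d)) % d     ≡⟨ %-distribˡ-* a′ b′ d ⟨
      (a′ * b′) % d                 ∎
      where open ≡-Reasoning

    ^-cong-≈ : ∀ {a b} k → a ≈ b → a ^ k ≈ b ^ k
    ^-cong-≈ zero _ = refl
    ^-cong-≈ {a} {b} (suc k) a≈b = *-cong-≈ {a} {b} {a ^ k} {b ^ k} a≈b (^-cong-≈ k a≈b)

    ≈1⇒^≈1 : ∀ {a} k → a ≈ 1 → a ^ k ≈ 1
    ≈1⇒^≈1 {a} k a≈1 = trans (^-cong-≈ {a} {1} k a≈1) (cong (_% d) (^-zeroˡ k))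

    *-mod-commutativeMonoid : CommutativeMonoid 0ℓ 0ℓ
    *-mod-commutativeMonoid = record
      { Carrier = ℕ ; _≈_ = _≈_ ; _∙_ = _*_ ; ε = 1
      ; isCommutativeMonoid = record
        { isMonoid = record
          { isSemigroup = record
            { isMagma = record
              { isEquivalence = record { refl = refl ; sym = sym ; trans = trans }
              ; ∙-cong = λ {a} {a′} {b} {b′} → *-cong-≈ {a} {a′} {b} {b′} }
            ; assoc = λ a b c → cong (_% d) (*-assoc a b c) }
          ; identity = (λ a → cong (_% d) (*-identityˡ a)) , (λ a → cong (_% d) (*-identityʳ a)) }
        ; comm = λ a b → cong (_% d) (*-comm a b) } }

    open CommutativeMonoidSum *-mod-commutativeMonoid using () renaming (sum to ∏; ∑-permute to ∏-permute; sum-cong-≋ to ∏-cong; ∑-distrib-+ to ∏-distrib-*)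

    Unit : ℕ → Set
    Unit a = ∃ λ b → a * b ≈ 1

    Unit-resp-≈ : ∀ {a a′} → a ≈ a′ → Unit a → Unit a′
    Unit-resp-≈ {a} {a′} a≈a′ (b , ab≈1) = b , trans (sym (*-cong-≈ {a} {a′} {b} {b} a≈a′ refl)) ab≈1

    Unit-* : ∀ {a c} → Unit a → Unit c → Unit (a * c)
    Unit-* {a} {c} (b , ab≈1) (b′ , cb′≈1) = b * b′ , (begin
      (a * c * (b * b′)) % d      ≡⟨ cong (_% d) (interchange a c b b′) ⟩
      ((a * b) * (c * b′)) % d    ≡⟨ *-cong-≈ {a * b} {1} {c * b′} {1} ab≈1 cb′≈1 ⟩
      1                           ∎)
      where
      open ≡-Reasoning
      interchange : ∀ a c b b′ → a * c * (b * b′) ≡ (a * b) * (c * b′)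
      interchange = solve-∀

    Unit-∏ : ∀ {m} (f : Fin m → ℕ) → (∀ i → Unit (f i)) → Unit (∏ f)
    Unit-∏ {zero} f _ = 1 , refl
    Unit-∏ {suc m} f units = Unit-* {f Fin.zero} (units Fin.zero) (Unit-∏ (f ∘ Fin.suc) (units ∘ Fin.suc))

    Unit⇒coprime : ∀ a → Unit a → gcd a d ≡ 1
    Unit⇒coprime a (b , ab≈1) =
      ∣1⇒≡1 (subst (gcd a d ∣_) ab≈1 (%-presˡ-∣ (∣-trans (gcd[m,n]∣m a d) (m∣m*n b)) (gcd[m,n]∣n a d)))

    ≈-1⇒square≈1 : ∀ a → a % d ≡ suc e → a * a ≈ 1
    ≈-1⇒square≈1 a a≈-1 = begin
      (a * a) % d                  ≡⟨ %-distribˡ-* a a d ⟩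
      ((a % d) * (a % d)) % d      ≡⟨ cong₂ (λ x y → (x * y) % d) a≈-1 a≈-1 ⟩
      (suc e * suc e) % d          ≡⟨ cong (λ x → suc x % d) (sym (*-suc e (suc e))) ⟩
      (1 + e * d) % d              ≡⟨ [m+kn]%n≡m%n 1 e d ⟩
      1                            ∎
      where open ≡-Reasoning

    coprime⇒Unit : ∀ a → gcd a d ≡ 1 → Unit a
    coprime⇒Unit a gcd≡1 with Bézout.identity (subst (GCD a d) gcd≡1 (gcd-GCD a d))
    ... | Bézout.Identity.+- x y 1+yd≡xa = x , (begin
      (a * x) % d        ≡⟨ cong (_% d) (trans (*-comm a x) (sym 1+yd≡xa)) ⟩
      (1 + y * d) % d    ≡⟨ [m+kn]%n≡m%n 1 y d ⟩
      1                  ∎)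
      where open ≡-Reasoning
    -- here x·a ≡ -1 (mod d), so a·(x·(x·a)) = (x·a)² ≡ 1
    ... | Bézout.Identity.-+ x y 1+xa≡yd = x * (x * a) , (begin
      (a * (x * (x * a))) % d   ≡⟨ cong (_% d) (trans (sym (*-assoc a x _)) (cong (_* (x * a)) (*-comm a x))) ⟩
      ((x * a) * (x * a)) % d   ≡⟨ ≈-1⇒square≈1 (x * a) (%-pred-≡0 {x * a} {d} (trans (cong (_% d) 1+xa≡yd) (m*n%n≡0 y d))) ⟩
      1                         ∎)
      where open ≡-Reasoning

    ≈0⇒¬Unit : ∀ k → k ≈ 0 → ¬ Unit k
    ≈0⇒¬Unit k k≈0 (b , kb≈1) with trans (sym (*-cong-≈ {k} {0} {b} {b} k≈0 refl)) kb≈1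
    ... | ()

    coprime? : ∀ k → Dec (gcd k d ≡ 1)
    coprime? k = gcd k d ≟ 1

    ¬coprime[d] : ¬ gcd d d ≡ 1
    ¬coprime[d] = ≈0⇒¬Unit d (n%n≡0 d) ∘ coprime⇒Unit d

    φ≡#coprime-1…d-1 : φ d ≡ length (filter coprime? (applyUpTo suc (suc e)))
    φ≡#coprime-1…d-1 = begin
      φ d                                                    ≡⟨ cong (length ∘ filter coprime?) (Listₚ.applyUpTo-∷ʳ suc (suc e)) ⟨
      length (filter coprime? (applyUpTo suc (suc e) ∷ʳ d))  ≡⟨ cong length (Listₚ.filter-++ coprime? (applyUpTo suc (suc e)) (d ∷ [])) ⟩
      length (filter coprime? (applyUpTo suc (suc e)) ++ filter coprime? (d ∷ []))
        ≡⟨ cong (λ xs → length (filter coprime? (applyUpTo suc (suc e)) ++ xs)) (Listₚ.filter-reject coprime? {d} {[]} ¬coprime[d]) ⟩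
      length (filter coprime? (applyUpTo suc (suc e)) ++ [])  ≡⟨ cong length (Listₚ.++-identityʳ (filter coprime? (applyUpTo suc (suc e)))) ⟩
      length (filter coprime? (applyUpTo suc (suc e)))       ∎
      where open ≡-Reasoning

    φ≡#coprime-0…d-1 : φ d ≡ length (filter coprime? (upTo d))
    φ≡#coprime-0…d-1 = trans φ≡#coprime-1…d-1
      (cong length (sym (Listₚ.filter-reject coprime? {0} {applyUpTo suc (suc e)} (≈0⇒¬Unit 0 refl ∘ coprime⇒Unit 0))))

    whenCoprime : ℕ → ℕ → ℕ
    whenCoprime x k with coprime? k
    ... | yes _ = x
    ... | no _ = 1

    whenCoprime-yes : ∀ x k → gcd k d ≡ 1 → whenCoprime x k ≡ x
    whenCoprime-yes x k coprime with coprime? k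
    ... | yes _ = refl
    ... | no ¬coprime = ⊥-elim (¬coprime coprime)

    whenCoprime-no : ∀ x k → ¬ gcd k d ≡ 1 → whenCoprime x k ≡ 1
    whenCoprime-no x k ¬coprime with coprime? k
    ... | yes coprime = ⊥-elim (¬coprime coprime)
    ... | no _ = refl

    product-whenCoprime : ∀ x m (g : ℕ → ℕ) →
      product (applyUpTo (whenCoprime x ∘ g) m) ≡ x ^ length (filter coprime? (applyUpTo g m))
    product-whenCoprime x zero g = refl
    product-whenCoprime x (suc m) g = byCases (coprime? (g 0))
      where
      ih = product-whenCoprime x m (g ∘ suc)
      byCases : Dec (gcd (g 0) d ≡ 1) →
        product (applyUpTo (whenCoprime x ∘ g) (suc m)) ≡ x ^ length (filter coprime? (applyUpTo g (suc m)))
      byCases (yes c) = trans (cong₂ _*_ (whenCoprime-yes x (g 0) c) ih)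
                              (cong (λ l → x ^ length l) (sym (Listₚ.filter-accept coprime? {g 0} {applyUpTo (g ∘ suc) m} c)))
      byCases (no ¬c) = trans (cong₂ _*_ (whenCoprime-no x (g 0) ¬c) ih)
                              (trans (+-identityʳ _) (cong (λ l → x ^ length l) (sym (Listₚ.filter-reject coprime? {g 0} {applyUpTo (g ∘ suc) m} ¬c))))

    ∏[whenCoprime]≡^φ : ∀ x → ∏ (λ (i : Fin d) → whenCoprime x (toℕ i)) ≡ x ^ φ d
    ∏[whenCoprime]≡^φ x = trans (toList d (whenCoprime x)) (trans (product-whenCoprime x d (λ k → k)) (cong (x ^_) (sym φ≡#coprime-0…d-1)))
      where
      toList : ∀ m (f : ℕ → ℕ) → ∏ {m} (f ∘ toℕ) ≡ product (applyUpTo f m)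
      toList zero f = refl
      toList (suc m) f = cong (f 0 *_) (toList m (f ∘ suc))

    whenCoprime-Unit : ∀ k → Unit (whenCoprime k k)
    whenCoprime-Unit k with coprime? k
    ... | yes coprime = coprime⇒Unit k coprime
    ... | no _ = 1 , refl

    mulMod : ℕ → Fin d → Fin d
    mulMod a i = fromℕ< (m%n<n (a * toℕ i) d)

    toℕ-mulMod : ∀ a i → toℕ (mulMod a i) ≈ a * toℕ i
    toℕ-mulMod a i = trans (cong (_% d) (Finₚ.toℕ-fromℕ< (m%n<n (a * toℕ i) d))) (%-≈ (a * toℕ i))

    mulMod-inverse : ∀ a b → b * a ≈ 1 → ∀ i → mulMod b (mulMod a i) ≡ i
    mulMod-inverse a b ba≈1 i = Finₚ.toℕ-injective (begin
      toℕ (mulMod b (mulMod a i))   ≡⟨ m<n⇒m%n≡m (Finₚ.toℕ<n _) ⟨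
      toℕ (mulMod b (mulMod a i)) % d ≡⟨ toℕ-mulMod b (mulMod a i) ⟩
      (b * toℕ (mulMod a i)) % d    ≡⟨ *-cong-≈ {b} {b} {toℕ (mulMod a i)} {a * toℕ i} refl (toℕ-mulMod a i) ⟩
      (b * (a * toℕ i)) % d         ≡⟨ cong (_% d) (*-assoc b a (toℕ i)) ⟨
      ((b * a) * toℕ i) % d         ≡⟨ *-cong-≈ {b * a} {1} {toℕ i} {toℕ i} ba≈1 refl ⟩
      (1 * toℕ i) % d               ≡⟨ cong (_% d) (*-identityˡ (toℕ i)) ⟩
      toℕ i % d                     ≡⟨ m<n⇒m%n≡m (Finₚ.toℕ<n i) ⟩
      toℕ i                         ∎)
      where open ≡-Reasoning

    coprime-mulMod : ∀ a → Unit a → ∀ i → gcd (toℕ i) d ≡ 1 → gcd (toℕ (mulMod a i)) d ≡ 1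
    coprime-mulMod a unit i coprime = Unit⇒coprime (toℕ (mulMod a i))
      (Unit-resp-≈ {a * toℕ i} {toℕ (mulMod a i)} (sym (toℕ-mulMod a i)) (Unit-* {a} {toℕ i} unit (coprime⇒Unit (toℕ i) coprime)))

    unitPart : Fin d → ℕ
    unitPart i = whenCoprime (toℕ i) (toℕ i)

    unitPart-mulMod : ∀ r r′ → r′ * r ≈ 1 → ∀ i → unitPart (mulMod r i) ≈ whenCoprime r (toℕ i) * unitPart i
    unitPart-mulMod r r′ r′r≈1 i = byCases (coprime? (toℕ i))
      where
      rr′≈1 : r * r′ ≈ 1
      rr′≈1 = trans (cong (_% d) (*-comm r r′)) r′r≈1
      byCases : Dec (gcd (toℕ i) d ≡ 1) → unitPart (mulMod r i) ≈ whenCoprime r (toℕ i) * unitPart i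
      byCases (yes coprime) = begin
        unitPart (mulMod r i) % d                   ≡⟨ cong (_% d) (whenCoprime-yes (toℕ (mulMod r i)) (toℕ (mulMod r i)) (coprime-mulMod r (r′ , rr′≈1) i coprime)) ⟩
        toℕ (mulMod r i) % d                        ≡⟨ toℕ-mulMod r i ⟩
        (r * toℕ i) % d                             ≡⟨ cong₂ (λ x y → (x * y) % d) (whenCoprime-yes r (toℕ i) coprime) (whenCoprime-yes (toℕ i) (toℕ i) coprime) ⟨
        (whenCoprime r (toℕ i) * unitPart i) % d    ∎
        where open ≡-Reasoning
      byCases (no ¬coprime) = cong (_% d) (begin
        unitPart (mulMod r i)                       ≡⟨ whenCoprime-no (toℕ (mulMod r i)) (toℕ (mulMod r i)) ¬coprime′ ⟩
        1                                           ≡⟨ cong₂ _*_ (whenCoprime-no r (toℕ i) ¬coprime) (whenCoprime-no (toℕ i) (toℕ i) ¬coprime) ⟨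
        whenCoprime r (toℕ i) * unitPart i          ∎)
        where
        open ≡-Reasoning
        ¬coprime′ : ¬ gcd (toℕ (mulMod r i)) d ≡ 1
        ¬coprime′ coprime = ¬coprime (subst (λ j → gcd (toℕ j) d ≡ 1) (mulMod-inverse r r′ r′r≈1 i)
                                              (coprime-mulMod r′ (r , r′r≈1) (mulMod r i) coprime))

    -- Multiplication by the unit r permutes the residues mod d and multiplies each
    -- residue coprime to d by r; comparing products of those residues gives r^φ(d) ≡ 1.
    euler : ∀ r → Unit r → r ^ φ d ≈ 1
    euler r (r′ , rr′≈1) = begin
      R % d                ≡⟨ cong (_% d) (*-identityʳ R) ⟨
      (R * 1) % d          ≡⟨ *-cong-≈ {R} {R} {1} {P * P⁻¹} refl (sym PP⁻¹≈1) ⟩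
      (R * (P * P⁻¹)) % d  ≡⟨ cong (_% d) (*-assoc R P P⁻¹) ⟨
      ((R * P) * P⁻¹) % d  ≡⟨ *-cong-≈ {R * P} {P} {P⁻¹} {P⁻¹} (sym P≈RP) refl ⟩
      (P * P⁻¹) % d        ≡⟨ PP⁻¹≈1 ⟩
      1                    ∎
      where
      open ≡-Reasoning
      R = r ^ φ d
      P = ∏ unitPart
      P⁻¹ = proj₁ (Unit-∏ unitPart (whenCoprime-Unit ∘ toℕ))
      PP⁻¹≈1 : P * P⁻¹ ≈ 1
      PP⁻¹≈1 = proj₂ (Unit-∏ unitPart (whenCoprime-Unit ∘ toℕ))
      r′r≈1 : r′ * r ≈ 1
      r′r≈1 = trans (cong (_% d) (*-comm r′ r)) rr′≈1
      π : Perm.Permutation′ d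
      π = Perm.permutation (mulMod r) (mulMod r′) (mulMod-inverse r′ r rr′≈1) (mulMod-inverse r r′ r′r≈1)
      P≈RP : P ≈ R * P
      P≈RP = begin
        P % d                                                ≡⟨ ∏-permute unitPart π ⟩
        ∏ (unitPart ∘ mulMod r) % d                          ≡⟨ ∏-cong {d} {unitPart ∘ mulMod r} {λ i → whenCoprime r (toℕ i) * unitPart i} (unitPart-mulMod r r′ r′r≈1) ⟩
        ∏ (λ i → whenCoprime r (toℕ i) * unitPart i) % d     ≡⟨ ∏-distrib-* (whenCoprime r ∘ toℕ {d}) unitPart ⟩
        (∏ (whenCoprime r ∘ toℕ {d}) * P) % d                ≡⟨ cong (λ x → (x * P) % d) (∏[whenCoprime]≡^φ r) ⟩
        (R * P) % d                                          ∎

    exponents⇒≈1 : ∀ {r a b} x y → r ^ a ≈ 1 → r ^ b ≈ 1 → 1 + x * a ≡ y * b → r ≈ 1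
    exponents⇒≈1 {r} {a} {b} x y r^a≈1 r^b≈1 1+xa≡yb = begin
      r % d                    ≡⟨ cong (_% d) (*-identityʳ r) ⟨
      (r * 1) % d              ≡⟨ *-cong-≈ {r} {r} {1} {(r ^ a) ^ x} refl (sym (≈1⇒^≈1 x r^a≈1)) ⟩
      (r * (r ^ a) ^ x) % d    ≡⟨ cong (λ t → (r * t) % d) (^-*-assoc r a x) ⟩
      r ^ (1 + a * x) % d      ≡⟨ cong (λ t → r ^ t % d) (trans (cong suc (*-comm a x)) 1+xa≡yb) ⟩
      r ^ (y * b) % d          ≡⟨ cong (λ t → r ^ t % d) (*-comm y b) ⟩
      r ^ (b * y) % d          ≡⟨ cong (_% d) (^-*-assoc r b y) ⟨
      (r ^ b) ^ y % d          ≡⟨ ≈1⇒^≈1 y r^b≈1 ⟩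
      1                        ∎
      where open ≡-Reasoning

    ^d≈1⇒≈1 : ∀ r → gcd d (φ d) ≡ 1 → r ^ d ≈ 1 → r ≈ 1
    ^d≈1⇒≈1 r coprime r^d≈1 = byBézout (Bézout.identity (subst (GCD d (φ d)) coprime (gcd-GCD d (φ d))))
      where
      r^φ≈1 : r ^ φ d ≈ 1
      r^φ≈1 = euler r (r ^ suc e , r^d≈1)
      byBézout : Bézout.Identity 1 d (φ d) → r ≈ 1
      byBézout (Bézout.Identity.+- x y 1+yφ≡xd) = exponents⇒≈1 y x r^φ≈1 r^d≈1 1+yφ≡xd
      byBézout (Bézout.Identity.-+ x y 1+xd≡yφ) = exponents⇒≈1 x y r^d≈1 r^φ≈1 1+xd≡yφ

    geometricSum-≈ : ∀ r → r ≈ 1 → ∀ k → geometricSum r k ≈ k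
    geometricSum-≈ r r≈1 zero = refl
    geometricSum-≈ r r≈1 (suc k) = begin
      (1 + r * geometricSum r k) % d               ≡⟨ %-distribˡ-+ 1 (r * geometricSum r k) d ⟩
      (1 % d + (r * geometricSum r k) % d) % d     ≡⟨ cong (λ t → (1 % d + t) % d) (*-cong-≈ {r} {1} {geometricSum r k} {k} r≈1 (geometricSum-≈ r r≈1 k)) ⟩
      (1 % d + (1 * k) % d) % d                    ≡⟨ cong (λ t → (1 % d + t % d) % d) (*-identityˡ k) ⟩
      (1 % d + k % d) % d                          ≡⟨ %-distribˡ-+ 1 k d ⟨
      (1 + k) % d                                  ∎
      where open ≡-Reasoning

    d∣geometricSum : ∀ r → gcd d (φ d) ≡ 1 → r ^ d ≈ 1 → d ∣ geometricSum r d
    d∣geometricSum r coprime r^d≈1 =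
      m%n≡0⇒n∣m (geometricSum r d) d (trans (geometricSum-≈ r (^d≈1⇒≈1 r coprime r^d≈1) d) (n%n≡0 d))

    prime⇒coprime[d,φd] : Prime d → gcd d (φ d) ≡ 1
    prime⇒coprime[d,φd] d-prime with prime⇒irreducible d-prime (gcd[m,n]∣m d (φ d))
    ... | inj₁ gcd≡1 = gcd≡1
    ... | inj₂ gcd≡d = ⊥-elim (<⇒≱ φ<d (∣⇒≤ ⦃ φ≢0 ⦄ (subst (_∣ φ d) gcd≡d (gcd[m,n]∣n d (φ d)))))
      where
      φ<d : φ d < d
      φ<d = s≤s (begin
        φ d                                               ≡⟨ φ≡#coprime-1…d-1 ⟩
        length (filter coprime? (applyUpTo suc (suc e)))  ≤⟨ Listₚ.length-filter coprime? (applyUpTo suc (suc e)) ⟩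
        length (applyUpTo suc (suc e))                    ≡⟨ Listₚ.length-applyUpTo suc (suc e) ⟩
        suc e                                             ∎)
        where open ≤-Reasoning
      φ≢0 : NonZero (φ d)
      φ≢0 = subst NonZero (sym φ≡#coprime-1…d-1)
        (subst (NonZero ∘ length) (sym (Listₚ.filter-accept coprime? {1} {applyUpTo (suc ∘ suc) e} (gcd-zeroˡ d))) _)

module ListCounting where
  open import Level using (0ℓ)
  open import Data.Nat using (ℕ; suc; _≤_; _+_; _*_; z≤n)
  open import Data.Nat.Properties using (+-mono-≤; *-suc; +-suc; module ≤-Reasoning)
  open import Data.List using (List; []; _∷_; length; filter)
  open import Data.List.Relation.Unary.All as All using (All; []; _∷_)
  import Data.List.Relation.Unary.All.Properties as Allₚ
  open import Data.List.Relation.Unary.AllPairs using (AllPairs; []; _∷_)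
  open import Data.List.Relation.Unary.Any using (here; there)
  open import Data.List.Relation.Unary.Unique.Propositional using (Unique)
  import Data.List.Relation.Unary.Unique.Propositional.Properties as Uniqueₚ
  open import Data.List.Membership.Propositional using (_∈_)
  open import Data.Product using (_,_)
  open import Data.Empty using (⊥-elim)
  open import Relation.Unary using (Pred; Decidable)
  open import Relation.Unary.Properties using (∁?)
  open import Relation.Nullary using (yes; no)
  open import Relation.Binary.Definitions using (DecidableEquality)
  open import Relation.Binary.PropositionalEquality

  length-filter-∁ : ∀ {A : Set} {P : Pred A 0ℓ} (P? : Decidable P) xs →
    length xs ≡ length (filter P? xs) + length (filter (∁? P?) xs)
  length-filter-∁ P? [] = refl
  length-filter-∁ P? (x ∷ xs) with P? x
  ... | yes _ = cong suc (length-filter-∁ P? xs)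
  ... | no _ = trans (cong suc (length-filter-∁ P? xs)) (sym (+-suc _ _))

  All⇒AllPairs : ∀ {A : Set} {P : A → Set} {R : A → A → Set} → (∀ {x y} → P x → P y → x ≢ y → R x y) →
    ∀ {xs} → All P xs → Unique xs → AllPairs R xs
  All⇒AllPairs r [] [] = []
  All⇒AllPairs r (px ∷ pxs) (x∉xs ∷ unique) =
    All.zipWith (λ (x≢y , py) → r px py x≢y) (x∉xs , pxs) ∷ All⇒AllPairs r pxs unique

  module _ {A B : Set} (_≟_ : DecidableEquality B) (f : A → B) (m : ℕ)
           (fibre≤m : ∀ y xs → Unique xs → All (λ x → f x ≡ y) xs → length xs ≤ m) where

    length≤m*length : ∀ ys {xs} → Unique xs → All (λ x → f x ∈ ys) xs → length xs ≤ m * length ys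
    length≤m*length [] {[]} _ _ = z≤n
    length≤m*length [] {_ ∷ _} _ (() ∷ _)
    length≤m*length (y ∷ ys) {xs} unique maps = begin
      length xs                    ≡⟨ length-filter-∁ fibre? xs ⟩
      length fibre + length rest   ≤⟨ +-mono-≤ (fibre≤m y fibre (Uniqueₚ.filter⁺ fibre? unique) (Allₚ.all-filter fibre? xs))
                                               (length≤m*length ys (Uniqueₚ.filter⁺ (∁? fibre?) unique) rest↦ys) ⟩
      m + m * length ys            ≡⟨ *-suc m (length ys) ⟨
      m * suc (length ys)          ∎
      where
      open ≤-Reasoning
      fibre? : Decidable (λ x → f x ≡ y)
      fibre? x = f x ≟ y
      fibre = filter fibre? xs
      rest = filter (∁? fibre?) xs
      dropHead : ∀ {x} → f x ∈ y ∷ ys → f x ≢ y → f x ∈ ys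
      dropHead (here fx≡y) fx≢y = ⊥-elim (fx≢y fx≡y)
      dropHead (there fx∈ys) _ = fx∈ys
      rest↦ys : All (λ x → f x ∈ ys) rest
      rest↦ys = All.zipWith (λ (fx∈y∷ys , fx≢y) → dropHead fx∈y∷ys fx≢y)
                            (Allₚ.filter⁺ (∁? fibre?) maps , Allₚ.all-filter (∁? fibre?) xs)

module FiniteFieldProperties {n : ℕ} (F : FiniteField (suc n)) where
  open import Level using (0ℓ)
  open import Function using (_∘_)
  open import Data.Nat as ℕ using (ℕ; zero; suc; _≤_; z≤n; s≤s; NonZero)
  import Data.Nat.Properties as ℕₚ
  open import Data.Nat.Divisibility using (_∣_; divides)
  open import Data.Nat.Primality using (Prime)
  open import Data.Nat.Combinatorics using (_C_; nCn≡1)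
  open import Data.Fin as Fin using (Fin; punchIn) renaming (_≟_ to _≟F_)
  import Data.Fin.Properties as Finₚ
  import Data.Fin.Permutation as Perm
  import Data.Vec.Functional as Vector
  import Data.Vec as Vec
  open import Data.List using (List; []; _∷_; length; map; filter; allFin; replicate)
  import Data.List.Properties as Listₚ
  open import Data.List.Relation.Unary.All as All using (All; []; _∷_)
  import Data.List.Relation.Unary.All.Properties as Allₚ
  open import Data.List.Relation.Unary.Unique.Propositional using (Unique)
  open import Data.List.Relation.Unary.AllPairs using ([]; _∷_)
  import Data.List.Relation.Unary.Unique.Propositional.Properties as Uniqueₚ
  open import Data.List.Membership.Propositional using (_∈_)
  import Data.List.Membership.Propositional.Properties as ∈ₚ
  open import Data.Product using (∃; _×_; _,_; proj₁; proj₂)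
  open import Data.Sum using (_⊎_; inj₁; inj₂)
  open import Data.Empty using (⊥-elim)
  open import Relation.Nullary using (yes; no)
  open import Relation.Unary.Properties using (∁?)
  open import Relation.Binary.PropositionalEquality
  open import Algebra.Bundles using (CommutativeRing)
  import Algebra.Bundles
  import Algebra.Properties.Group as GroupProperties
  import Algebra.Properties.RingWithoutOne as RingWithoutOneProperties
  import Algebra.Properties.CommutativeMonoid.Sum as CommutativeMonoidSum
  import Algebra.Properties.Monoid.Mult as MonoidMult
  import Algebra.Properties.Semiring.Mult as SemiringMult
  import Algebra.Properties.Semiring.Exp as SemiringExp
  import Algebra.Properties.CommutativeSemiring.Binomial as Binomial
  import Algebra.Solver.CommutativeMonoid as CommutativeMonoidSolver
  open import Defs
  open FiniteField F
  open PrimeBinomial using (prime∣pCk)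
  open ListCounting

  commutativeRing : CommutativeRing 0ℓ 0ℓ
  commutativeRing = record
    { Carrier = Fin (suc n) ; _≈_ = _≡_ ; _+_ = _+_ ; _*_ = _*_ ; -_ = -_
    ; 0# = 0# ; 1# = 1# ; isCommutativeRing = isCommutativeRing }

  private
    module R = CommutativeRing commutativeRing
    module +-Group = GroupProperties R.+-group
    module ∏ = CommutativeMonoidSum R.*-commutativeMonoid
    module ∑ = CommutativeMonoidSum R.+-commutativeMonoid
    module Exp = SemiringExp R.semiring
    module *-Mult = MonoidMult R.*-monoid
    open import Algebra.Definitions.RawSemiring (Algebra.Bundles.Semiring.rawSemiring R.semiring) using () renaming (_×_ to _·_)

  open ≡-Reasoning

  n≢0 : n ≢ 0
  n≢0 refl = 0≢1 (Fin1-unique 0# 1#)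
    where
    Fin1-unique : (a b : Fin 1) → a ≡ b
    Fin1-unique Fin.zero Fin.zero = refl

  x*y≡0⇒x≡0∨y≡0 : ∀ {x y} → x * y ≡ 0# → x ≡ 0# ⊎ y ≡ 0#
  x*y≡0⇒x≡0∨y≡0 {x} {y} xy≡0 with x ≟F 0#
  ... | yes x≡0 = inj₁ x≡0
  ... | no x≢0 with inverse x x≢0
  ...   | x⁻¹ , xx⁻¹≡1 = inj₂ (begin
    y                ≡⟨ R.*-identityˡ y ⟨
    1# * y           ≡⟨ cong (_* y) (trans (sym xx⁻¹≡1) (R.*-comm x x⁻¹)) ⟩
    (x⁻¹ * x) * y    ≡⟨ R.*-assoc x⁻¹ x y ⟩
    x⁻¹ * (x * y)    ≡⟨ cong (x⁻¹ *_) xy≡0 ⟩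
    x⁻¹ * 0#         ≡⟨ R.zeroʳ x⁻¹ ⟩
    0#               ∎)

  x*y≢0 : ∀ {x y} → x ≢ 0# → y ≢ 0# → x * y ≢ 0#
  x*y≢0 x≢0 y≢0 xy≡0 with x*y≡0⇒x≡0∨y≡0 xy≡0
  ... | inj₁ x≡0 = x≢0 x≡0
  ... | inj₂ y≡0 = y≢0 y≡0

  x-y≡0⇒x≡y : ∀ {x y} → x - y ≡ 0# → x ≡ y
  x-y≡0⇒x≡y {x} {y} = +-Group.x∙y⁻¹≈ε⇒x≈y x y

  x≢y⇒x-y≢0 : ∀ {x y} → x ≢ y → x - y ≢ 0#
  x≢y⇒x-y≢0 x≢y = x≢y ∘ x-y≡0⇒x≡y

  *-cancelˡ : ∀ {x y z} → x ≢ 0# → x * y ≡ x * z → y ≡ z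
  *-cancelˡ {x} {y} {z} x≢0 xy≡xz with x*y≡0⇒x≡0∨y≡0 x[y-z]≡0
    where
    x[y-z]≡0 : x * (y - z) ≡ 0#
    x[y-z]≡0 = trans (RingWithoutOneProperties.x[y-z]≈xy-xz (Algebra.Bundles.Ring.ringWithoutOne R.ring) x y z)
                     (trans (cong (_- (x * z)) xy≡xz) (R.-‿inverseʳ (x * z)))
  ... | inj₁ x≡0 = ⊥-elim (x≢0 x≡0)
  ... | inj₂ y-z≡0 = x-y≡0⇒x≡y y-z≡0

  x^k≢0 : ∀ {x} k → x ≢ 0# → x ^ k ≢ 0#
  x^k≢0 zero _ 1≡0 = 0≢1 (sym 1≡0)
  x^k≢0 (suc k) x≢0 = x*y≢0 x≢0 (x^k≢0 k x≢0)

  x^k≡0⇒x≡0 : ∀ {x} k → x ^ k ≡ 0# → x ≡ 0#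
  x^k≡0⇒x≡0 {x} k x^k≡0 with x ≟F 0#
  ... | yes x≡0 = x≡0
  ... | no x≢0 = ⊥-elim (x^k≢0 k x≢0 x^k≡0)

  0^k≡0 : ∀ k .{{_ : NonZero k}} → 0# ^ k ≡ 0#
  0^k≡0 (suc k) = R.zeroˡ (0# ^ k)

  ^≡Exp^ : ∀ x k → x ^ k ≡ x Exp.^ k
  ^≡Exp^ x zero = refl
  ^≡Exp^ x (suc k) = cong (x *_) (^≡Exp^ x k)

  ^-*-assoc : ∀ x a b → (x ^ a) ^ b ≡ x ^ (a ℕ.* b)
  ^-*-assoc x a b = begin
    (x ^ a) ^ b              ≡⟨ ^≡Exp^ (x ^ a) b ⟩
    (x ^ a) Exp.^ b          ≡⟨ cong (Exp._^ b) (^≡Exp^ x a) ⟩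
    (x Exp.^ a) Exp.^ b      ≡⟨ Exp.^-assocʳ x a b ⟩
    x Exp.^ (a ℕ.* b)        ≡⟨ ^≡Exp^ x (a ℕ.* b) ⟨
    x ^ (a ℕ.* b)            ∎

  whenNonzero : Fin (suc n) → Fin (suc n) → Fin (suc n)
  whenNonzero x y with y ≟F 0#
  ... | yes _ = 1#
  ... | no _ = x

  whenNonzero-no : ∀ x {y} → y ≢ 0# → whenNonzero x y ≡ x
  whenNonzero-no x {y} y≢0 with y ≟F 0#
  ... | yes y≡0 = ⊥-elim (y≢0 y≡0)
  ... | no _ = refl

  whenNonzero-yes : ∀ x → whenNonzero x 0# ≡ 1#
  whenNonzero-yes x with 0# ≟F 0#
  ... | yes _ = refl
  ... | no 0≢0 = ⊥-elim (0≢0 refl)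

  ∏-≢0 : ∀ {m} (f : Fin m → Fin (suc n)) → (∀ i → f i ≢ 0#) → ∏.sum f ≢ 0#
  ∏-≢0 {zero} f _ = 0≢1 ∘ sym
  ∏-≢0 {suc m} f f≢0 = x*y≢0 (f≢0 Fin.zero) (∏-≢0 (f ∘ Fin.suc) (f≢0 ∘ Fin.suc))

  ∏whenNonzero≡^n : ∀ x → ∏.sum (whenNonzero x) ≡ x ^ n
  ∏whenNonzero≡^n x = begin
    ∏.sum (whenNonzero x)                                        ≡⟨ ∏.sum-remove {i = 0#} (whenNonzero x) ⟩
    whenNonzero x 0# * ∏.sum (Vector.removeAt (whenNonzero x) 0#) ≡⟨ cong (_* ∏.sum (Vector.removeAt (whenNonzero x) 0#)) (whenNonzero-yes x) ⟩
    1# * ∏.sum (Vector.removeAt (whenNonzero x) 0#)               ≡⟨ R.*-identityˡ _ ⟩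
    ∏.sum (Vector.removeAt (whenNonzero x) 0#)                    ≡⟨ ∏.sum-cong-≗ (λ j → whenNonzero-no x (Finₚ.punchInᵢ≢i 0# j)) ⟩
    ∏.sum (Vector.replicate n x)                                 ≡⟨ ∏.sum-replicate n ⟩
    n *-Mult.× x                                                 ≡⟨ ×≡^ n ⟩
    x ^ n                                                        ∎
    where
    ×≡^ : ∀ k → k *-Mult.× x ≡ x ^ k
    ×≡^ zero = refl
    ×≡^ (suc k) = cong (x *_) (×≡^ k)

  *-permutation : ∀ {x} → x ≢ 0# → Perm.Permutation′ (suc n)
  *-permutation {x} x≢0 = Perm.permutation (x *_) (x⁻¹ *_) (cancel x x⁻¹ xx⁻¹≡1) (cancel x⁻¹ x (trans (R.*-comm x⁻¹ x) xx⁻¹≡1))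
    where
    x⁻¹ = proj₁ (inverse x x≢0)
    xx⁻¹≡1 : x * x⁻¹ ≡ 1#
    xx⁻¹≡1 = proj₂ (inverse x x≢0)
    cancel : ∀ a b → a * b ≡ 1# → ∀ y → a * (b * y) ≡ y
    cancel a b ab≡1 y = trans (sym (R.*-assoc a b y)) (trans (cong (_* y) ab≡1) (R.*-identityˡ y))

  -- Multiplication by x permutes the field; compare the products of whenNonzero y y
  -- over all y before and after the permutation.
  fermat : ∀ {x} → x ≢ 0# → x ^ n ≡ 1#
  fermat {x} x≢0 = sym (*-cancelˡ (∏-≢0 unitPart unitPart≢0) (trans (R.*-identityʳ P) P≡P*x^n))
    where
    unitPart : Fin (suc n) → Fin (suc n)
    unitPart y = whenNonzero y y
    unitPart≢0 : ∀ y → unitPart y ≢ 0#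
    unitPart≢0 y with y ≟F 0#
    ... | yes _ = 0≢1 ∘ sym
    ... | no y≢0 = y≢0
    P = ∏.sum unitPart
    unitPart-* : ∀ y → unitPart (x * y) ≡ whenNonzero x y * unitPart y
    unitPart-* y with y ≟F 0#
    ... | yes y≡0 = trans (cong unitPart (trans (cong (x *_) y≡0) (R.zeroʳ x)))
                          (trans (whenNonzero-yes 0#) (sym (R.*-identityˡ 1#)))
    ... | no y≢0 = whenNonzero-no (x * y) (x*y≢0 x≢0 y≢0)
    P≡P*x^n : P ≡ P * x ^ n
    P≡P*x^n = begin
      P                                          ≡⟨ ∏.∑-permute unitPart (*-permutation x≢0) ⟩
      ∏.sum (unitPart ∘ (x *_))                  ≡⟨ ∏.sum-cong-≗ unitPart-* ⟩
      ∏.sum (λ y → whenNonzero x y * unitPart y) ≡⟨ ∏.∑-distrib-+ (whenNonzero x) unitPart ⟩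
      ∏.sum (whenNonzero x) * P                  ≡⟨ cong (_* P) (∏whenNonzero≡^n x) ⟩
      x ^ n * P                                  ≡⟨ R.*-comm _ P ⟩
      P * x ^ n                                  ∎

  -- Translation by 1 permutes the field, so the sum S of all elements satisfies S = S + q·1.
  [1+n]·1≡0 : suc n · 1# ≡ 0#
  [1+n]·1≡0 = +-Group.identityʳ-unique S _ (sym S≡S+q·1)
    where
    S = ∑.sum (λ y → y)
    π : Perm.Permutation′ (suc n)
    π = Perm.permutation (_+ 1#) (_- 1#)
          (λ y → trans (R.+-assoc y (- 1#) 1#) (trans (cong (y +_) (R.-‿inverseˡ 1#)) (R.+-identityʳ y)))
          (λ y → trans (R.+-assoc y 1# (- 1#)) (trans (cong (y +_) (R.-‿inverseʳ 1#)) (R.+-identityʳ y)))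
    S≡S+q·1 : S ≡ S + suc n · 1#
    S≡S+q·1 = begin
      S                                       ≡⟨ ∑.∑-permute (λ y → y) π ⟩
      ∑.sum (_+ 1#)                           ≡⟨ ∑.∑-distrib-+ (λ y → y) (λ _ → 1#) ⟩
      S + ∑.sum (Vector.replicate (suc n) 1#) ≡⟨ cong (S +_) (∑.sum-replicate (suc n)) ⟩
      S + suc n · 1#                          ∎

  p·1≡0 : ∀ p s → p ℕ.^ s ≡ suc n → p · 1# ≡ 0#
  p·1≡0 p s p^s≡q = x^k≡0⇒x≡0 s (begin
    (p · 1#) ^ s       ≡⟨ ·1-^ s ⟨
    (p ℕ.^ s) · 1#     ≡⟨ cong (_· 1#) p^s≡q ⟩
    suc n · 1#         ≡⟨ [1+n]·1≡0 ⟩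
    0#                 ∎)
    where
    ·1-^ : ∀ k → (p ℕ.^ k) · 1# ≡ (p · 1#) ^ k
    ·1-^ zero = R.+-identityʳ 1#
    ·1-^ (suc k) = trans (SemiringMult.×1-homo-* R.semiring p (p ℕ.^ k)) (cong ((p · 1#) *_) (·1-^ k))

  multiple-of-char·x≡0 : ∀ {p c} → p · 1# ≡ 0# → p ∣ c → ∀ x → c · x ≡ 0#
  multiple-of-char·x≡0 {p} p·1≡0 (divides m refl) x = begin
    (m ℕ.* p) · x                ≡⟨ cong ((m ℕ.* p) ·_) (R.*-identityˡ x) ⟨
    (m ℕ.* p) · (1# * x)         ≡⟨ SemiringMult.×-assoc-* R.semiring (m ℕ.* p) 1# x ⟨
    ((m ℕ.* p) · 1#) * x         ≡⟨ cong (_* x) (SemiringMult.×1-homo-* R.semiring m p) ⟩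
    ((m · 1#) * (p · 1#)) * x    ≡⟨ cong (λ z → ((m · 1#) * z) * x) p·1≡0 ⟩
    ((m · 1#) * 0#) * x          ≡⟨ cong (_* x) (R.zeroʳ (m · 1#)) ⟩
    0# * x                       ≡⟨ R.zeroˡ x ⟩
    0#                           ∎

  AdditivePower : ℕ → Set
  AdditivePower r = ∀ x y → (x + y) ^ r ≡ x ^ r + y ^ r

  -- In the binomial expansion of (x + y)^p every middle coefficient p C k is a multiple of p.
  frobenius : ∀ {p} → Prime p → p · 1# ≡ 0# → AdditivePower p
  frobenius {suc (suc p′)} p-prime p·1≡0 x y = begin
    (x + y) ^ p                                          ≡⟨ ^≡Exp^ (x + y) p ⟩
    (x + y) Exp.^ p                                      ≡⟨ Binomial.theorem R.commutativeSemiring p x y ⟩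
    term Fin.zero + ∑.sum (term ∘ Fin.suc)               ≡⟨ cong₂ _+_ first (∑.sum-init-last (term ∘ Fin.suc)) ⟩
    y ^ p + (∑.sum (Vector.init (term ∘ Fin.suc)) + term (Fin.fromℕ p))
                                                         ≡⟨ cong (λ z → y ^ p + (z + term (Fin.fromℕ p))) middle ⟩
    y ^ p + (0# + term (Fin.fromℕ p))                    ≡⟨ cong (y ^ p +_) (trans (R.+-identityˡ _) last) ⟩
    y ^ p + x ^ p                                        ≡⟨ R.+-comm _ _ ⟩
    x ^ p + y ^ p                                        ∎
    where
    p = suc (suc p′)
    term = Binomial.binomialTerm R.commutativeSemiring x y p
    first : term Fin.zero ≡ y ^ p
    first = trans (R.+-identityʳ _) (trans (R.*-identityˡ _) (sym (^≡Exp^ y p)))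
    last : term (Fin.fromℕ p) ≡ x ^ p
    last = begin
      (p C Fin.toℕ (Fin.fromℕ p)) · (x Exp.^ Fin.toℕ (Fin.fromℕ p) * y Exp.^ (p ℕ.∸ Fin.toℕ (Fin.fromℕ p)))
        ≡⟨ cong (λ k → (p C k) · (x Exp.^ k * y Exp.^ (p ℕ.∸ k))) (Finₚ.toℕ-fromℕ p) ⟩
      (p C p) · (x Exp.^ p * y Exp.^ (p ℕ.∸ p))  ≡⟨ cong₂ (λ c e → c · (x Exp.^ p * y Exp.^ e)) (nCn≡1 p) (ℕₚ.n∸n≡0 p) ⟩
      1 · (x Exp.^ p * 1#)                       ≡⟨ trans (R.+-identityʳ _) (R.*-identityʳ _) ⟩
      x Exp.^ p                                  ≡⟨ ^≡Exp^ x p ⟨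
      x ^ p                                      ∎
    middle : ∑.sum (Vector.init (term ∘ Fin.suc)) ≡ 0#
    middle = trans (∑.sum-cong-≗ vanishes) (∑.sum-replicate-zero (suc p′))
      where
      vanishes : ∀ i → term (Fin.suc (Fin.inject₁ i)) ≡ 0#
      vanishes i = multiple-of-char·x≡0 p·1≡0
        (prime∣pCk p-prime (s≤s z≤n) (s≤s (subst (ℕ._< suc p′) (sym (Finₚ.toℕ-inject₁ i)) (Finₚ.toℕ<n i)))) _

  additivePower-^ : ∀ {p} → AdditivePower p → ∀ t → AdditivePower (p ℕ.^ t)
  additivePower-^ {p} additive zero x y =
    trans (R.*-identityʳ _) (cong₂ _+_ (sym (R.*-identityʳ x)) (sym (R.*-identityʳ y)))
  additivePower-^ {p} additive (suc t) x y = begin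
    (x + y) ^ (p ℕ.* p ℕ.^ t)                    ≡⟨ ^-*-assoc (x + y) p (p ℕ.^ t) ⟨
    ((x + y) ^ p) ^ (p ℕ.^ t)                    ≡⟨ cong (_^ (p ℕ.^ t)) (additive x y) ⟩
    (x ^ p + y ^ p) ^ (p ℕ.^ t)                  ≡⟨ additivePower-^ additive t (x ^ p) (y ^ p) ⟩
    (x ^ p) ^ (p ℕ.^ t) + (y ^ p) ^ (p ℕ.^ t)    ≡⟨ cong₂ _+_ (^-*-assoc x p (p ℕ.^ t)) (^-*-assoc y p (p ℕ.^ t)) ⟩
    x ^ (p ℕ.* p ℕ.^ t) + y ^ (p ℕ.* p ℕ.^ t)    ∎

  Fixed : ℕ → Fin (suc n) → Set
  Fixed r x = x ^ r ≡ x

  fixed-sub : ∀ {r x y} → AdditivePower r → Fixed r x → Fixed r y → Fixed r (x - y)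
  fixed-sub {r} {x} {y} additive x^r≡x y^r≡y = +-Group.∙-cancelʳ y _ _ (begin
    (x - y) ^ r + y         ≡⟨ cong ((x - y) ^ r +_) y^r≡y ⟨
    (x - y) ^ r + y ^ r     ≡⟨ additive (x - y) y ⟨
    ((x - y) + y) ^ r       ≡⟨ cong (_^ r) [x-y]+y≡x ⟩
    x ^ r                   ≡⟨ x^r≡x ⟩
    x                       ≡⟨ [x-y]+y≡x ⟨
    (x - y) + y             ∎)
    where
    [x-y]+y≡x : (x - y) + y ≡ x
    [x-y]+y≡x = trans (R.+-assoc x (- y) y) (trans (cong (x +_) (R.-‿inverseˡ y)) (R.+-identityʳ x))

  -- monic (c₀ ∷ … ∷ cₖ₋₁) x = c₀ + c₁ x + … + cₖ₋₁ x^(k-1) + x^k: coefficients from low to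
  -- high, with the leading coefficient 1 left implicit.
  monic : List (Fin (suc n)) → Fin (suc n) → Fin (suc n)
  monic [] x = 1#
  monic (c ∷ cs) x = c + x * monic cs x

  private
    horner-step : ∀ c x a Q A → c + x * ((x - a) * Q + A) ≡ (x - a) * (A + x * Q) + (c + a * A)
    horner-step c x a Q A = sym (begin
      (x - a) * (A + x * Q) + (c + a * A)                  ≡⟨ cong (_+ (c + a * A)) (R.distribˡ (x - a) A (x * Q)) ⟩
      ((x - a) * A + (x - a) * (x * Q)) + (c + a * A)      ≡⟨ cong (λ z → ((x - a) * A + z) + (c + a * A)) (x∙yz≈y∙xz (x - a) x Q) ⟩
      ((x - a) * A + x * ((x - a) * Q)) + (c + a * A)      ≡⟨ rearrange _ _ c _ ⟩
      c + (x * ((x - a) * Q) + ((x - a) * A + a * A))      ≡⟨ cong (λ z → c + (x * ((x - a) * Q) + z)) (sym (R.distribʳ A (x - a) a)) ⟩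
      c + (x * ((x - a) * Q) + ((x - a) + a) * A)          ≡⟨ cong (λ z → c + (x * ((x - a) * Q) + z * A)) [x-a]+a≡x ⟩
      c + (x * ((x - a) * Q) + x * A)                      ≡⟨ cong (c +_) (R.distribˡ x _ A) ⟨
      c + x * ((x - a) * Q + A)                            ∎)
      where
      open import Algebra.Properties.CommutativeSemigroup R.*-commutativeSemigroup using (x∙yz≈y∙xz)
      [x-a]+a≡x : (x - a) + a ≡ x
      [x-a]+a≡x = trans (R.+-assoc x (- a) a) (trans (cong (x +_) (R.-‿inverseˡ a)) (R.+-identityʳ x))
      rearrange : ∀ u v w z → (u + v) + (w + z) ≡ w + (v + (u + z))
      rearrange u v w z = prove 4 ((u′ ⊕ v′) ⊕ (w′ ⊕ z′)) (w′ ⊕ (v′ ⊕ (u′ ⊕ z′))) (u Vec.∷ v Vec.∷ w Vec.∷ z Vec.∷ Vec.[])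
        where
        open CommutativeMonoidSolver R.+-commutativeMonoid using (prove; _⊕_; var)
        u′ = var Fin.zero
        v′ = var (Fin.suc Fin.zero)
        w′ = var (Fin.suc (Fin.suc Fin.zero))
        z′ = var (Fin.suc (Fin.suc (Fin.suc Fin.zero)))

  -- The quotient Q is built by Horner's scheme, one coefficient at a time.
  factor-theorem : ∀ a c cs → ∃ λ Q → length Q ≡ length cs × (∀ x → monic (c ∷ cs) x ≡ (x - a) * monic Q x + monic (c ∷ cs) a)
  factor-theorem a c [] = [] , refl , λ x → begin
    c + x * 1#                        ≡⟨ cong (c +_) (R.*-identityʳ x) ⟩
    c + x                             ≡⟨ cong (c +_) (sym [x-a]+a≡x) ⟩
    c + ((x - a) + a)                 ≡⟨ R.+-comm c _ ⟩
    ((x - a) + a) + c                 ≡⟨ R.+-assoc _ a c ⟩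
    (x - a) + (a + c)                 ≡⟨ cong₂ _+_ (sym (R.*-identityʳ _)) (R.+-comm a c) ⟩
    (x - a) * 1# + (c + a)            ≡⟨ cong (λ z → (x - a) * 1# + (c + z)) (sym (R.*-identityʳ a)) ⟩
    (x - a) * 1# + (c + a * 1#)       ∎
    where
    [x-a]+a≡x : ∀ {x} → (x - a) + a ≡ x
    [x-a]+a≡x {x} = trans (R.+-assoc x (- a) a) (trans (cong (x +_) (R.-‿inverseˡ a)) (R.+-identityʳ x))
  factor-theorem a c (c′ ∷ cs) with factor-theorem a c′ cs
  ... | Q , |Q|≡|cs| , division = monic (c′ ∷ cs) a ∷ Q , cong suc |Q|≡|cs| , λ x → begin
    c + x * monic (c′ ∷ cs) x                                   ≡⟨ cong (λ z → c + x * z) (division x) ⟩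
    c + x * ((x - a) * monic Q x + monic (c′ ∷ cs) a)          ≡⟨ horner-step c x a _ _ ⟩
    (x - a) * (monic (c′ ∷ cs) a + x * monic Q x) + (c + a * monic (c′ ∷ cs) a) ∎

  roots≤degree : ∀ cs (rs : List (Fin (suc n))) → Unique rs → All (λ r → monic cs r ≡ 0#) rs → length rs ≤ length cs
  roots≤degree cs [] _ _ = z≤n
  roots≤degree [] (a ∷ rs) _ (1≡0 ∷ _) = ⊥-elim (0≢1 (sym 1≡0))
  roots≤degree (c ∷ cs) (a ∷ rs) (a∉rs ∷ unique) (root ∷ roots) with factor-theorem a c cs
  ... | Q , |Q|≡|cs| , division =
    s≤s (subst (length rs ≤_) |Q|≡|cs| (roots≤degree Q rs unique (All.zipWith rootOfQuotient (a∉rs , roots))))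
    where
    rootOfQuotient : ∀ {b} → a ≢ b × monic (c ∷ cs) b ≡ 0# → monic Q b ≡ 0#
    rootOfQuotient {b} (a≢b , root′) with x*y≡0⇒x≡0∨y≡0 (begin
      (b - a) * monic Q b                          ≡⟨ R.+-identityʳ _ ⟨
      (b - a) * monic Q b + 0#                     ≡⟨ cong ((b - a) * monic Q b +_) root ⟨
      (b - a) * monic Q b + monic (c ∷ cs) a       ≡⟨ division b ⟨
      monic (c ∷ cs) b                             ≡⟨ root′ ⟩
      0#                                           ∎)
    ... | inj₁ b-a≡0 = ⊥-elim (a≢b (sym (x-y≡0⇒x≡y b-a≡0)))
    ... | inj₂ Q[b]≡0 = Q[b]≡0

  roots[x^k≡c]≤k : ∀ k .{{_ : NonZero k}} c (rs : List (Fin (suc n))) → Unique rs → All (λ r → r ^ k ≡ c) rs → length rs ≤ k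
  roots[x^k≡c]≤k (suc k) c rs unique roots =
    subst (length rs ≤_) (cong suc (Listₚ.length-replicate k))
      (roots≤degree (- c ∷ replicate k 0#) rs unique (All.map root roots))
    where
    monic-x^k : ∀ k x → monic (replicate k 0#) x ≡ x ^ k
    monic-x^k zero x = refl
    monic-x^k (suc k) x = trans (R.+-identityˡ _) (cong (x *_) (monic-x^k k x))
    root : ∀ {r} → r ^ suc k ≡ c → monic (- c ∷ replicate k 0#) r ≡ 0#
    root {r} r^k≡c = begin
      - c + r * monic (replicate k 0#) r   ≡⟨ cong (λ z → - c + r * z) (monic-x^k k r) ⟩
      - c + r ^ suc k                                ≡⟨ R.+-comm _ _ ⟩
      (r ^ suc k) - c                                ≡⟨ cong (_- c) r^k≡c ⟩
      c - c                                          ≡⟨ R.-‿inverseʳ c ⟩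
      0#                                             ∎

  units : List (Fin (suc n))
  units = map (punchIn 0#) (allFin n)

  units-unique : Unique units
  units-unique = Uniqueₚ.map⁺ (λ {i} {j} → Finₚ.punchIn-injective 0# i j) (Uniqueₚ.allFin⁺ n)

  length-units : length units ≡ n
  length-units = trans (Listₚ.length-map (punchIn 0#) (allFin n)) (Listₚ.length-tabulate (λ i → i))

  units≢0 : All (_≢ 0#) units
  units≢0 = Allₚ.map⁺ (Allₚ.tabulate⁺ (Finₚ.punchInᵢ≢i 0#))

  rootsOfUnity : ℕ → List (Fin (suc n))
  rootsOfUnity m = filter (λ y → y ^ m ≟F 1#) (allFin (suc n))

  rootsOfUnity-unique : ∀ m → Unique (rootsOfUnity m)
  rootsOfUnity-unique m = Uniqueₚ.filter⁺ (λ y → y ^ m ≟F 1#) (Uniqueₚ.allFin⁺ (suc n))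

  rootsOfUnity-roots : ∀ m → All (λ y → y ^ m ≡ 1#) (rootsOfUnity m)
  rootsOfUnity-roots m = Allₚ.all-filter (λ y → y ^ m ≟F 1#) (allFin (suc n))

  ∈-rootsOfUnity : ∀ {m y} → y ^ m ≡ 1# → y ∈ rootsOfUnity m
  ∈-rootsOfUnity {m} {y} = ∈ₚ.∈-filter⁺ (λ y → y ^ m ≟F 1#) (∈ₚ.∈-allFin y)

  module PowerResidues (k m : ℕ) (k*m≡n : k ℕ.* m ≡ n) where

    instance
      k≢0 : NonZero k
      k≢0 = ℕ.≢-nonZero (λ { refl → n≢0 (sym k*m≡n) })
      m≢0 : NonZero m
      m≢0 = ℕ.≢-nonZero (λ { refl → n≢0 (trans (sym k*m≡n) (ℕₚ.*-zeroʳ k)) })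

    ^k-unit∈rootsOfUnity : All (λ b → b ^ k ∈ rootsOfUnity m) units
    ^k-unit∈rootsOfUnity = All.map (λ {b} b≢0 → ∈-rootsOfUnity {m} (begin
      (b ^ k) ^ m       ≡⟨ ^-*-assoc b k m ⟩
      b ^ (k ℕ.* m)     ≡⟨ cong (b ^_) k*m≡n ⟩
      b ^ n             ≡⟨ fermat b≢0 ⟩
      1#                ∎)) units≢0

    private
      n≤k*length : ∀ ys → All (λ b → b ^ k ∈ ys) units → n ≤ k ℕ.* length ys
      n≤k*length ys ^k∈ys = subst (_≤ k ℕ.* length ys) length-units
        (length≤m*length _≟F_ (_^ k) k (roots[x^k≡c]≤k k) ys units-unique ^k∈ys)

      m≤length : ∀ ys → All (λ b → b ^ k ∈ ys) units → m ≤ length ys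
      m≤length ys ^k∈ys = ℕₚ.*-cancelˡ-≤ k (subst (_≤ k ℕ.* length ys) (sym k*m≡n) (n≤k*length ys ^k∈ys))

    m≤#rootsOfUnity : m ≤ length (rootsOfUnity m)
    m≤#rootsOfUnity = m≤length (rootsOfUnity m) ^k-unit∈rootsOfUnity

    rootOfUnity⇒power : ∀ {y} → y ^ m ≡ 1# → ∃ λ b → b ^ k ≡ y
    rootOfUnity⇒power {y} y^m≡1 with Finₚ.any? (λ b → b ^ k ≟F y)
    ... | yes power = power
    -- Otherwise the k-th powers of all units lie among the other m-th roots of unity,
    -- which number at least m by counting and at most m - 1 by the root bound.
    ... | no ¬power = ⊥-elim (ℕₚ.<⇒≱ (roots[x^k≡c]≤k m 1# (y ∷ others) (y∉others ∷ others-unique) (y^m≡1 ∷ others-roots))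
                                       (m≤length others ^k-unit∈others))
      where
      ≢y? = ∁? (_≟F y)
      others = filter ≢y? (rootsOfUnity m)
      others-unique : Unique others
      others-unique = Uniqueₚ.filter⁺ ≢y? (rootsOfUnity-unique m)
      y∉others : All (y ≢_) others
      y∉others = All.map (λ z≢y → z≢y ∘ sym) (Allₚ.all-filter ≢y? (rootsOfUnity m))
      others-roots : All (λ z → z ^ m ≡ 1#) others
      others-roots = Allₚ.filter⁺ ≢y? (rootsOfUnity-roots m)
      ^k-unit∈others : All (λ b → b ^ k ∈ others) units
      ^k-unit∈others = All.tabulate (λ {b} b∈units →
        ∈ₚ.∈-filter⁺ ≢y? (All.lookup ^k-unit∈rootsOfUnity b∈units) (λ b^k≡y → ¬power (b , b^k≡y)))

  subfieldClique : ∀ m k d → k ℕ.* m ≡ n → d ∣ k → AdditivePower (suc m) →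
    ∃ λ xs → IsGPClique F d xs × suc m ≤ length xs
  subfieldClique m k d k*m≡n (divides k/d k≡k/d*d) additive =
    0# ∷ rootsOfUnity m , All⇒AllPairs adjacent fixed unique , s≤s m≤#rootsOfUnity
    where
    open PowerResidues k m k*m≡n
    fixed : All (Fixed (suc m)) (0# ∷ rootsOfUnity m)
    fixed = R.zeroˡ _ ∷ All.map (λ {y} y^m≡1 → trans (cong (y *_) y^m≡1) (R.*-identityʳ y)) (rootsOfUnity-roots m)
    unique : Unique (0# ∷ rootsOfUnity m)
    unique = All.map (λ 0^m≡1 0≡y → 0≢1 (trans (sym (0^k≡0 m)) (subst (λ z → z ^ m ≡ 1#) (sym 0≡y) 0^m≡1))) (rootsOfUnity-roots m)
           ∷ rootsOfUnity-unique m
    adjacent : ∀ {x y} → Fixed (suc m) x → Fixed (suc m) y → x ≢ y → GPAdj F d x y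
    adjacent {x} {y} x-fixed y-fixed x≢y with rootOfUnity⇒power w^m≡1
      where
      w = x - y
      w^m≡1 : w ^ m ≡ 1#
      w^m≡1 = *-cancelˡ (x≢y⇒x-y≢0 x≢y) (trans (fixed-sub {suc m} additive x-fixed y-fixed) (sym (R.*-identityʳ w)))
    ... | b , b^k≡x-y = x≢y , b ^ k/d , (begin
      x - y                ≡⟨ b^k≡x-y ⟨
      b ^ k                ≡⟨ cong (b ^_) k≡k/d*d ⟩
      b ^ (k/d ℕ.* d)      ≡⟨ ^-*-assoc b k/d d ⟨
      (b ^ k/d) ^ d        ∎)


open import Defs
open import Data.Nat using (ℕ; _+_; _*_; _^_; _≤_; _<_; _∸_)
open import Data.Nat.Divisibility using (_∣_)
open import Data.Nat.GCD using (gcd)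
open import Data.Nat.Primality using (Prime)
open import Data.List using (List; length)
open import Data.Product using (∃; _×_; _,_)
open import Relation.Binary.PropositionalEquality using (_≡_; _≢_)
open import Data.Nat using (zero; suc; pred; s≤s; _%_; NonZero)
open import Data.Nat.Properties using (^-*-assoc; ^-monoˡ-≤; suc-pred; suc-injective; *-comm; m^n≢0)
open import Data.Nat.DivMod using ([m+kn]%n≡m%n)
open import Data.Nat.Divisibility using (divides; ∣-trans; n∣m*n)
open import Data.Nat.Primality using (prime⇒nonZero)
open import Data.Fin.Properties using (¬Fin0)
open import Data.Empty using (⊥-elim)
open import Function using (_∘_)
open import Relation.Binary.PropositionalEquality using (sym; trans; cong; subst; module ≡-Reasoning)

subfieldClique-of-size-q^[1/d] : ∀ {n} (F : FiniteField (suc n)) {d} m → 1 < d → suc m ^ d ≡ suc n →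
  FiniteFieldProperties.AdditivePower F (suc m) → gcd d (φ d) ≡ 1 → d ∣ n →
  ∃ λ (xs : List _) → IsGPClique F d xs × suc n ≤ length xs ^ d
subfieldClique-of-size-q^[1/d] {n} F {suc zero} m (s≤s ()) _ _ _ _
subfieldClique-of-size-q^[1/d] {n} F {d@(suc (suc e))} m _ r^d≡q additive coprime (divides c n≡c*d) =
  let (xs , clique , r≤|xs|) = subfieldClique m k d k*m≡n d∣k additive
  in xs , clique , subst (_≤ length xs ^ d) r^d≡q (^-monoˡ-≤ d r≤|xs|)
  where
  open FiniteFieldProperties F using (subfieldClique)
  open Totient using (geometricSum; [1+m]^k≡1+m*geometricSum)
  k = geometricSum (suc m) d
  k*m≡n : k * m ≡ n
  k*m≡n = trans (*-comm k m) (suc-injective (trans (sym ([1+m]^k≡1+m*geometricSum m d)) r^d≡q))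
  d∣k : d ∣ k
  d∣k = Totient.Modulo.d∣geometricSum e (suc m) coprime (begin
    suc m ^ d % d        ≡⟨ cong (_% d) r^d≡q ⟩
    (1 + n) % d          ≡⟨ cong (λ x → (1 + x) % d) n≡c*d ⟩
    (1 + c * d) % d      ≡⟨ [m+kn]%n≡m%n 1 c d ⟩
    1 % d                ∎)
    where open ≡-Reasoning

prime⇒gcd[d,φd]≡1 : ∀ {d} → 1 < d → Prime d → gcd d (φ d) ≡ 1
prime⇒gcd[d,φd]≡1 {suc zero} (s≤s ())
prime⇒gcd[d,φd]≡1 {suc (suc e)} _ = Totient.Modulo.prime⇒coprime[d,φd] e

proposition5p6-coprime : (p s d q : ℕ) → Prime p → q ≡ p ^ s → 1 < d
  → (F : FiniteField q) → (2 * d) ∣ (q ∸ 1) → d ∣ s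
  → gcd d (φ d) ≡ 1 → ∃ λ (xs : List _) → IsGPClique F d xs × q ≤ length xs ^ d
proposition5p6-coprime p s d zero _ _ _ F _ _ _ = ⊥-elim (¬Fin0 (FiniteField.0# F))
proposition5p6-coprime p s d (suc n) p-prime q≡p^s 1<d F 2d∣n (divides t s≡t*d) coprime =
  subfieldClique-of-size-q^[1/d] F (pred r) 1<d r^d≡q additive coprime (∣-trans (n∣m*n 2) 2d∣n)
  where
  open FiniteFieldProperties F using (AdditivePower; frobenius; p·1≡0; additivePower-^)
  r : ℕ
  r = p ^ t
  instance
    r≢0 : NonZero r
    r≢0 = m^n≢0 p t ⦃ prime⇒nonZero p-prime ⦄
  r^d≡q : suc (pred r) ^ d ≡ suc n
  r^d≡q = trans (cong (_^ d) (suc-pred r)) (trans (^-*-assoc p t d) (trans (cong (p ^_) (sym s≡t*d)) (sym q≡p^s)))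
  additive : AdditivePower (suc (pred r))
  additive = subst AdditivePower (sym (suc-pred r)) (additivePower-^ (frobenius p-prime (p·1≡0 p s (sym q≡p^s))) t)

proposition5p6 : (p s d q : ℕ) → Prime p → p ≢ 2 → q ≡ p ^ s → 1 < d
    → (F : FiniteField q) → (2 * d) ∣ (q ∸ 1) → d ∣ s
    → (gcd d (φ d) ≡ 1 → ∃ λ (xs : List _) → IsGPClique F d xs × q ≤ length xs ^ d)
    × (Prime d → ∃ λ (xs : List _) → IsGPClique F d xs × q ≤ length xs ^ d)
proposition5p6 p s d q p-prime _ q≡p^s 1<d F 2d∣q-1 d∣s =
  clique , clique ∘ prime⇒gcd[d,φd]≡1 1<d
  where
  clique : gcd d (φ d) ≡ 1 → ∃ λ (xs : List _) → IsGPClique F d xs × q ≤ length xs ^ d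
  clique = proposition5p6-coprime p s d q p-prime q≡p^s 1<d F 2d∣q-1 d∣s
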